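{- Let $\mathcal{V}$ and $\mathcal{W}$ be vector bundles on the Fargues–Fontaine curve $X$. (1) $\mathcal{V}$ slopewise dominates $\mathcal{W}$ if and only if $\mathrm{rk}(\mathcal{V}^{\geq\mu})\geq\mathrm{rk}(\mathcal{W}^{\geq\mu})$ for every $\mu\in\mathbb{Q}$. (2) $\mathcal{V}^\vee$ slopewise dominates $\mathcal{W}^\vee$ if and only if $\mathrm{rk}(\mathcal{V}^{\leq\mu})\geq\mathrm{rk}(\mathcal{W}^{\leq\mu})$ for every $\mu\in\mathbb{Q}$.
   Context: $X$ is the Fargues–Fontaine curve attached to a finite extension $E/\mathbb{Q}_p$ and an algebraically closed perfectoid field $F$ of characteristic $p$. Every vector bundle $\mathcal{V}$ has a unique HN decomposition $\mathcal{V}\simeq\bigoplus_i\mathcal{O}(\lambda_i)^{\oplus m_i}$ ($\lambda_1>\lambda_2>\cdots$, $\mathcal{O}(\lambda)$ the stable bundle of slope $\lambda$, of rank the denominator of $\lambda$); $\mathrm{HN}(\mathcal{V})$ is the concave polygon from the origin with successive edges of slopes $\lambda_i$ and horizontal lengths $m_i\,\mathrm{rk}\,\mathcal{O}(\lambda_i)$. $\mathcal{V}^{\geq\mu}:=\bigoplus_{\lambda_i\geq\mu}\mathcal{O}(\lambda_i)^{\oplus m_i}$, $\mathcal{V}^{\leq\mu}:=\bigoplus_{\lambda_i\leq\mu}\mathcal{O}(\lambda_i)^{\oplus m_i}$; $\mathcal{V}^\vee$ is the dual bundle. Definition: with $\mathrm{HN}(\mathcal{V})$ and $\mathrm{HN}(\mathcal{W})$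 both having left endpoint at the origin, $\mathcal{V}$ slopewise dominates $\mathcal{W}$ if for each $i=1,\dots,\mathrm{rk}(\mathcal{W})$ the slope of $\mathrm{HN}(\mathcal{W})$ on $[i-1,i]$ is at most the slope of $\mathrm{HN}(\mathcal{V})$ on $[i-1,i]$ (in particular $\mathrm{rk}\mathcal{V}\geq\mathrm{rk}\mathcal{W}$). -}

module Defs where

open import Data.Nat as ℕ using (ℕ; zero; suc; NonZero)
open import Data.Rational as ℚ using (ℚ; _≤_; _<_; -_; 0ℚ)
open import Data.Rational.Properties using (_≤?_)
open import Data.Nat.ListAction using (sum)
open import Data.List using (List; []; _∷_; map; filter; concatMap; replicate; reverse)
open import Data.List.Relation.Unary.All using (All)
open import Data.List.Relation.Unary.Linked using (Linked)
open import Data.Product using (_×_; _,_; proj₁; proj₂)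

-- A vector bundle on the Fargues–Fontaine curve, up to isomorphism, is
-- recorded by its HN decomposition  ⊕ᵢ O(λᵢ)^{⊕ mᵢ} : the list of pairs (λᵢ , mᵢ).
HNData : Set
HNData = List (ℚ × ℕ)

IsHN : HNData → Set
IsHN V = Linked (λ a b → proj₁ b < proj₁ a) V × All (λ a → NonZero (proj₂ a)) V

rkO : ℚ → ℕ
rkO s = ℚ.denominatorℕ s

rkPart : ℚ × ℕ → ℕ
rkPart (s , m) = m ℕ.* rkO s

rank : HNData → ℕ
rank V = sum (map rkPart V)

geq : ℚ → HNData → HNData
geq μ V = filter (λ p → μ ≤? proj₁ p) V

leq : ℚ → HNData → HNData
leq μ V = filter (λ p → proj₁ p ≤? μ) V

-- dual bundle: (⊕ O(λᵢ)^{mᵢ})^∨ = ⊕ O(-λᵢ)^{mᵢ}, listed in decreasing slope order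
dual : HNData → HNData
dual V = reverse (map (λ p → (- proj₁ p , proj₂ p)) V)

-- slopes of HN(V) on the unit intervals [0,1], [1,2], …, [rk V - 1, rk V]:
-- edge of slope λᵢ has horizontal length mᵢ · rk O(λᵢ)
slopes : HNData → List ℚ
slopes V = concatMap (λ p → replicate (rkPart p) (proj₁ p)) V

-- slope of HN(V) on [i, i+1] (0-indexed); default value only used out of range
slopeAt : HNData → ℕ → ℚ
slopeAt V i = go (slopes V) i
  where
  go : List ℚ → ℕ → ℚ
  go []       _       = 0ℚ
  go (x ∷ xs) zero    = x
  go (x ∷ xs) (suc i) = go xs i

SlopewiseDominates : HNData → HNData → Set
SlopewiseDominates V W =
  rank W ℕ.≤ rank V × (∀ (i : ℕ) → i ℕ.< rank W → slopeAt W i ≤ slopeAt V i)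

-- Listing these slopes in decreasing order, rk V^{≥μ} is the
-- number of entries ≥ μ, and for two decreasing lists "termwise larger"
-- is equivalent to "at least as many entries ≥ μ, for every μ": if the
-- (i+1)-st entry of the smaller list exceeded that of the larger one, taking
-- μ to be it would give the smaller list more entries ≥ μ.  Part (2) is
-- part (1) for the duals, since (V^∨)^{≥μ} = (V^{≤ -μ})^∨ has the same rank
-- as V^{≤ -μ}.
module Submission where

open import Defs
open import Data.Nat using (_≤_)
open import Data.Rational using (ℚ)
open import Data.Product using (_×_)
open import Function.Bundles using (_⇔_)

open import Data.Nat as ℕ using (ℕ; zero; suc; z≤n; s≤s; s≤s⁻¹; _+_)
open import Data.Rational as ℚ using (mkℚ; -_; 0ℚ)
import Data.Rational.Properties as ℚ
open import Data.Rational.Properties using (_≤?_)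
open import Data.Integer using (+_; -[1+_])
open import Algebra.Properties.Group ℚ.+-0-group using (⁻¹-involutive)
open import Data.Nat.ListAction.Properties using (sum-↭)
open import Data.List using (List; []; _∷_; _++_; map; filter; replicate; reverse; length; drop)
open import Data.List.Properties
  using (length-++; length-replicate; filter-accept; filter-none; filter-all; filter-++; filter-≐; unfold-reverse)
open import Data.List.Relation.Unary.All as All using (All; []; _∷_)
import Data.List.Relation.Unary.All.Properties as All
open import Data.List.Relation.Unary.AllPairs as AllPairs using (AllPairs; []; _∷_)
import Data.List.Relation.Unary.AllPairs.Properties as AllPairs
open import Data.List.Relation.Unary.Linked.Properties using (Linked⇒AllPairs)
open import Data.List.Relation.Binary.Permutation.Propositional using (_↭_; ↭-sym)
import Data.List.Relation.Binary.Permutation.Propositional.Properties as ↭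
open import Data.Product using (_,_; proj₁)
open import Relation.Nullary using (yes; no; contradiction)
open import Relation.Unary using (Pred; Decidable)
open import Relation.Binary.PropositionalEquality using (_≡_; refl; sym; trans; cong; cong₂; subst; subst₂; module ≡-Reasoning)
open import Function using (_∘_; flip)
open import Function.Bundles using (mk⇔)
import Function.Properties.Equivalence as ⇔
open import Level using (Level)

private
  variable
    a b p r : Level
    A : Set a
    B : Set b
    x y μ : ℚ
    xs ys : List ℚ
    V W : HNData

AllPairs-replicate⁺ : {R : A → A → Set r} {z : A} → R z z → ∀ n → AllPairs R (replicate n z)
AllPairs-replicate⁺ Rzz zero    = []
AllPairs-replicate⁺ Rzz (suc n) = All.replicate⁺ n Rzz ∷ AllPairs-replicate⁺ Rzz n

AllPairs-reverse⁺ : {R : A → A → Set r} {zs : List A} → AllPairs R zs → AllPairs (flip R) (reverse zs)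
AllPairs-reverse⁺ [] = []
AllPairs-reverse⁺ {R = R} {z ∷ zs} (Rz ∷ Rzs) = subst (AllPairs (flip R)) (sym (unfold-reverse z zs))
  (AllPairs.++⁺ (AllPairs-reverse⁺ Rzs) ([] ∷ [])
                (↭.All-resp-↭ (↭-sym (↭.↭-reverse zs)) (All.map (_∷ []) Rz)))

filter-map : {P : Pred B p} (P? : Decidable P) (f : A → B) (zs : List A) →
             filter P? (map f zs) ≡ map f (filter (P? ∘ f) zs)
filter-map P? f []       = refl
filter-map P? f (z ∷ zs) with P? (f z)
... | yes _ = cong (f z ∷_) (filter-map P? f zs)
... | no  _ = filter-map P? f zs

-- Out of range this returns 0ℚ, as slopeAt does.
index : List ℚ → ℕ → ℚ
index []       _       = 0ℚ
index (z ∷ zs) zero    = z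
index (z ∷ zs) (suc i) = index zs i

Descending : List ℚ → Set
Descending = AllPairs (flip ℚ._≤_)

record PointwiseDominates (xs ys : List ℚ) : Set where
  constructor pointwise
  field
    length≤ : length ys ≤ length xs
    index≤  : ∀ i → i ℕ.< length ys → index ys i ℚ.≤ index xs i

PointwiseDominates-∷ : y ℚ.≤ x → PointwiseDominates xs ys → PointwiseDominates (x ∷ xs) (y ∷ ys)
PointwiseDominates-∷ y≤x (pointwise len dom) = pointwise (s≤s len) λ where
  zero    _         → y≤x
  (suc i) (s≤s i<n) → dom i i<n

PointwiseDominates-uncons : PointwiseDominates (x ∷ xs) (y ∷ ys) → y ℚ.≤ x × PointwiseDominates xs ys
PointwiseDominates-uncons (pointwise (s≤s len) dom) = dom 0 (s≤s z≤n) , pointwise len λ i i<n → dom (suc i) (s≤s i<n)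

count≥ : ℚ → List ℚ → ℕ
count≥ μ xs = length (filter (μ ≤?_) xs)

count≥-accept : ∀ xs → μ ℚ.≤ x → count≥ μ (x ∷ xs) ≡ suc (count≥ μ xs)
count≥-accept {μ = μ} _ μ≤x = cong length (filter-accept (μ ≤?_) μ≤x)

count≥-none : All (ℚ._< μ) xs → count≥ μ xs ≡ 0
count≥-none {μ = μ} xs<μ = cong length (filter-none (μ ≤?_) (All.map (λ x<μ μ≤x → ℚ.<-irrefl refl (ℚ.<-≤-trans x<μ μ≤x)) xs<μ))

Descending-below : Descending (x ∷ xs) → x ℚ.< μ → All (ℚ._< μ) (x ∷ xs)
Descending-below (xs≤x ∷ _) x<μ = x<μ ∷ All.map (λ y≤x → ℚ.≤-<-trans y≤x x<μ) xs≤x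

count≥-mono : Descending ys → PointwiseDominates xs ys → ∀ μ → count≥ μ ys ≤ count≥ μ xs
count≥-mono {[]}     _   _               _ = z≤n
count≥-mono {_ ∷ _} {[]} _ (pointwise () _) _
count≥-mono {y ∷ ys} {x ∷ xs} ys↓@(_ ∷ ys′↓) dom μ with PointwiseDominates-uncons dom | μ ≤? y
... | y≤x , dom′ | yes μ≤y = subst₂ _≤_ (sym (count≥-accept ys μ≤y)) (sym (count≥-accept xs (ℚ.≤-trans μ≤y y≤x)))
                               (s≤s (count≥-mono ys′↓ dom′ μ))
... | _          | no  μ≰y = subst (_≤ count≥ μ (x ∷ xs)) (sym (count≥-none (Descending-below ys↓ (ℚ.≰⇒> μ≰y)))) z≤n

-- Take μ = y: if x < y, the descending list x ∷ xs has no entry ≥ y.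
head-dominated : Descending (x ∷ xs) → count≥ y (y ∷ ys) ≤ count≥ y (x ∷ xs) → y ℚ.≤ x
head-dominated {x = x} {y = y} {ys = ys} xs↓ count≤ with y ≤? x
... | yes y≤x = y≤x
... | no  y≰x = contradiction
  (subst₂ _≤_ (count≥-accept ys (ℚ.≤-refl {y})) (count≥-none (Descending-below xs↓ (ℚ.≰⇒> y≰x))) count≤) λ ()

tail-counts : Descending (y ∷ ys) → y ℚ.≤ x →
              (∀ μ → count≥ μ (y ∷ ys) ≤ count≥ μ (x ∷ xs)) → ∀ μ → count≥ μ ys ≤ count≥ μ xs
tail-counts {y = y} {ys = ys} {xs = xs} ys↓ y≤x counts≤ μ with μ ≤? y
... | yes μ≤y = s≤s⁻¹ (subst₂ _≤_ (count≥-accept ys μ≤y) (count≥-accept xs (ℚ.≤-trans μ≤y y≤x)) (counts≤ μ))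
... | no  μ≰y = subst (_≤ count≥ μ xs) (sym (count≥-none (All.tail (Descending-below ys↓ (ℚ.≰⇒> μ≰y))))) z≤n

count≥-mono⁻¹ : Descending xs → Descending ys →
                (∀ μ → count≥ μ ys ≤ count≥ μ xs) → PointwiseDominates xs ys
count≥-mono⁻¹ {xs}     {[]}     _ _ _ = pointwise z≤n λ _ ()
count≥-mono⁻¹ {[]}     {y ∷ ys} _ _ counts≤ =
  contradiction (subst (_≤ 0) (count≥-accept ys (ℚ.≤-refl {y})) (counts≤ y)) λ ()
count≥-mono⁻¹ {x ∷ xs} {y ∷ ys} xs↓@(_ ∷ xs′↓) ys↓@(_ ∷ ys′↓) counts≤ =
  PointwiseDominates-∷ y≤x (count≥-mono⁻¹ xs′↓ ys′↓ (tail-counts ys↓ y≤x counts≤))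
  where
  y≤x : y ℚ.≤ x
  y≤x = head-dominated xs↓ (counts≤ y)

PointwiseDominates⇔count≥ : Descending xs → Descending ys →
                            PointwiseDominates xs ys ⇔ (∀ μ → count≥ μ ys ≤ count≥ μ xs)
PointwiseDominates⇔count≥ xs↓ ys↓ = mk⇔ (count≥-mono ys↓) (count≥-mono⁻¹ xs↓ ys↓)

-- Defs does not export the local indexing function of slopeAt; slopeAt-go
-- names it, the metavariable being solved by unification in slopeAt-suc.
mutual
  slopeAt-go : HNData → ℕ → List ℚ → ℕ → ℚ
  slopeAt-go = _

  slopeAt-suc : ∀ V j → slopeAt V (suc j) ≡ slopeAt-go V (suc j) (drop 1 (slopes V)) j
  slopeAt-suc V j with slopes V
  ... | []    = refl
  ... | _ ∷ _ with suc j
  ...   | _ = refl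

slopeAt-go-index : ∀ V i zs k → slopeAt-go V i zs k ≡ index zs k
slopeAt-go-index V i []       _       = refl
slopeAt-go-index V i (z ∷ zs) zero    = refl
slopeAt-go-index V i (z ∷ zs) (suc k) = slopeAt-go-index V i zs k

slopeAt-index : ∀ V i → slopeAt V i ≡ index (slopes V) i
slopeAt-index V i with slopes V | slopeAt-suc V
slopeAt-index V i       | []     | _    = refl
slopeAt-index V zero    | _ ∷ _  | _    = refl
slopeAt-index V (suc j) | _ ∷ zs | step = trans (step j) (slopeAt-go-index V (suc j) zs j)

length-slopes : ∀ V → length (slopes V) ≡ rank V
length-slopes []      = refl
length-slopes (p ∷ V) = begin
  length (replicate (rkPart p) (proj₁ p) ++ slopes V)         ≡⟨ length-++ (replicate (rkPart p) (proj₁ p)) ⟩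
  length (replicate (rkPart p) (proj₁ p)) + length (slopes V) ≡⟨ cong₂ _+_ (length-replicate (rkPart p)) (length-slopes V) ⟩
  rank (p ∷ V)                                                ∎
  where open ≡-Reasoning

module _ {P : Pred ℚ p} (P? : Decidable P) where

  All-slopes : All (P ∘ proj₁) V → All P (slopes V)
  All-slopes []                    = []
  All-slopes {(s , m) ∷ V} (Ps ∷ PV) = All.++⁺ (All.replicate⁺ (rkPart (s , m)) Ps) (All-slopes PV)

  slopes-filter : ∀ V → slopes (filter (P? ∘ proj₁) V) ≡ filter P? (slopes V)
  slopes-filter []            = refl
  slopes-filter ((s , m) ∷ V) with P? s
  ... | yes Ps = begin
    replicate k s ++ slopes (filter (P? ∘ proj₁) V)    ≡⟨ cong₂ _++_ (sym (filter-all P? (All.replicate⁺ k Ps))) (slopes-filter V) ⟩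
    filter P? (replicate k s) ++ filter P? (slopes V)  ≡⟨ sym (filter-++ P? (replicate k s) (slopes V)) ⟩
    filter P? (replicate k s ++ slopes V)              ∎
    where open ≡-Reasoning; k = rkPart (s , m)
  ... | no ¬Ps = begin
    slopes (filter (P? ∘ proj₁) V)                              ≡⟨ cong (_++ _) (sym (filter-none P? (All.replicate⁺ k ¬Ps))) ⟩
    filter P? (replicate k s) ++ slopes (filter (P? ∘ proj₁) V) ≡⟨ cong (filter P? (replicate k s) ++_) (slopes-filter V) ⟩
    filter P? (replicate k s) ++ filter P? (slopes V)           ≡⟨ sym (filter-++ P? (replicate k s) (slopes V)) ⟩
    filter P? (replicate k s ++ slopes V)                       ∎
    where open ≡-Reasoning; k = rkPart (s , m)

rank-geq : ∀ μ V → rank (geq μ V) ≡ count≥ μ (slopes V)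
rank-geq μ V = trans (sym (length-slopes (geq μ V))) (cong length (slopes-filter (μ ≤?_) V))

slopes-descending : AllPairs (λ p q → proj₁ q ℚ.≤ proj₁ p) V → Descending (slopes V)
slopes-descending [] = []
slopes-descending {(s , m) ∷ V} (V≤s ∷ V↓) =
  AllPairs.++⁺ (AllPairs-replicate⁺ ℚ.≤-refl k) (slopes-descending V↓)
               (All.replicate⁺ k (All-slopes (_≤? s) V≤s))
  where k = rkPart (s , m)

IsHN⇒decreasing : IsHN V → AllPairs (λ p q → proj₁ q ℚ.< proj₁ p) V
IsHN⇒decreasing (linked , _) = Linked⇒AllPairs (λ p q → ℚ.<-trans q p) linked

IsHN⇒descending : IsHN V → Descending (slopes V)
IsHN⇒descending hV = slopes-descending (AllPairs.map ℚ.<⇒≤ (IsHN⇒decreasing hV))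

SlopewiseDominates⇔PointwiseDominates : SlopewiseDominates V W ⇔ PointwiseDominates (slopes V) (slopes W)
SlopewiseDominates⇔PointwiseDominates {V} {W} = mk⇔
  (λ (len , dom) → pointwise (subst₂ _≤_ (sym (length-slopes W)) (sym (length-slopes V)) len)
     λ i i<n → subst₂ ℚ._≤_ (slopeAt-index W i) (slopeAt-index V i) (dom i (subst (i ℕ.<_) (length-slopes W) i<n)))
  (λ (pointwise len dom) → subst₂ _≤_ (length-slopes W) (length-slopes V) len ,
     λ i i<n → subst₂ ℚ._≤_ (sym (slopeAt-index W i)) (sym (slopeAt-index V i)) (dom i (subst (i ℕ.<_) (sym (length-slopes W)) i<n)))

count≥⇔rank-geq : (∀ μ → count≥ μ (slopes W) ≤ count≥ μ (slopes V)) ⇔ (∀ μ → rank (geq μ W) ≤ rank (geq μ V))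
count≥⇔rank-geq {W} {V} = mk⇔
  (λ counts≤ μ → subst₂ _≤_ (sym (rank-geq μ W)) (sym (rank-geq μ V)) (counts≤ μ))
  (λ ranks≤ μ → subst₂ _≤_ (rank-geq μ W) (rank-geq μ V) (ranks≤ μ))

SlopewiseDominates⇔rank-geq : ∀ V W → Descending (slopes V) → Descending (slopes W) →
                              SlopewiseDominates V W ⇔ (∀ μ → rank (geq μ W) ≤ rank (geq μ V))
SlopewiseDominates⇔rank-geq V W V↓ W↓ = ⇔.trans (SlopewiseDominates⇔PointwiseDominates {V} {W})
  (⇔.trans (PointwiseDominates⇔count≥ V↓ W↓) (count≥⇔rank-geq {W} {V}))

negate : ℚ × ℕ → ℚ × ℕ
negate (s , m) = (- s , m)

rkO-neg : ∀ q → rkO (- q) ≡ rkO q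
rkO-neg (mkℚ -[1+ _ ]   _ _) = refl
rkO-neg (mkℚ (+ zero)   _ _) = refl
rkO-neg (mkℚ (+ suc _)  _ _) = refl

rank-map-negate : ∀ V → rank (map negate V) ≡ rank V
rank-map-negate []            = refl
rank-map-negate ((s , m) ∷ V) = cong₂ _+_ (cong (m ℕ.*_) (rkO-neg s)) (rank-map-negate V)

rank-↭ : V ↭ W → rank V ≡ rank W
rank-↭ V↭W = sum-↭ (↭.map⁺ rkPart V↭W)

neg-≤-swap : μ ℚ.≤ - x → x ℚ.≤ - μ
neg-≤-swap {μ} {x} μ≤-x = subst (ℚ._≤ - μ) (⁻¹-involutive x) (ℚ.neg-antimono-≤ μ≤-x)

rank-geq-dual : ∀ μ V → rank (geq μ (dual V)) ≡ rank (leq (- μ) V)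
rank-geq-dual μ V = begin
  rank (filter G (reverse (map negate V)))   ≡⟨ rank-↭ (↭.filter-↭ G (↭.↭-reverse (map negate V))) ⟩
  rank (filter G (map negate V))             ≡⟨ cong rank (filter-map G negate V) ⟩
  rank (map negate (filter (G ∘ negate) V))  ≡⟨ rank-map-negate (filter (G ∘ negate) V) ⟩
  rank (filter (G ∘ negate) V)               ≡⟨ cong rank (filter-≐ (G ∘ negate) (λ q → proj₁ q ≤? - μ) (neg-≤-swap , neg-≤-swap) V) ⟩
  rank (leq (- μ) V)                         ∎
  where
  open ≡-Reasoning
  G : Decidable (λ (q : ℚ × ℕ) → μ ℚ.≤ proj₁ q)
  G q = μ ≤? proj₁ q

dual-descending : IsHN V → Descending (slopes (dual V))
dual-descending hV = slopes-descending
  (AllPairs-reverse⁺ (AllPairs.map⁺ (AllPairs.map (ℚ.neg-antimono-≤ ∘ ℚ.<⇒≤) (IsHN⇒decreasing hV))))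

rank-geq-dual⇔rank-leq : (∀ μ → rank (geq μ (dual W)) ≤ rank (geq μ (dual V))) ⇔ (∀ μ → rank (leq μ W) ≤ rank (leq μ V))
rank-geq-dual⇔rank-leq {W} {V} = mk⇔
  (λ ranks≤ μ → subst₂ _≤_ (rank-geq-dual-neg μ W) (rank-geq-dual-neg μ V) (ranks≤ (- μ)))
  (λ ranks≤ μ → subst₂ _≤_ (sym (rank-geq-dual μ W)) (sym (rank-geq-dual μ V)) (ranks≤ (- μ)))
  where
  rank-geq-dual-neg : ∀ μ U → rank (geq (- μ) (dual U)) ≡ rank (leq μ U)
  rank-geq-dual-neg μ U = trans (rank-geq-dual (- μ) U) (cong (λ ν → rank (leq ν U)) (⁻¹-involutive μ))

lemma4p7 : (V W : HNData) → IsHN V → IsHN W →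
    (SlopewiseDominates V W ⇔ (∀ (μ : ℚ) → rank (geq μ W) ≤ rank (geq μ V)))
    × (SlopewiseDominates (dual V) (dual W) ⇔ (∀ (μ : ℚ) → rank (leq μ W) ≤ rank (leq μ V)))
lemma4p7 V W hV hW =
  SlopewiseDominates⇔rank-geq V W (IsHN⇒descending hV) (IsHN⇒descending hW) ,
  ⇔.trans (SlopewiseDominates⇔rank-geq (dual V) (dual W) (dual-descending hV) (dual-descending hW))
          (rank-geq-dual⇔rank-leq {W} {V})
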